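{- For every integer $n\geq 2$, \[DM(n,2)=\sum_{k=1}^{n-1}\ \sum_{\substack{n_{1}+\cdots+n_{k}=n \\ n_{i}\in \mathbb{Z}_{>0}}}\ \prod_{j=1}^k j^{\,n_j-1}.\]
   Context: A distance monoid is a structure $(R,\oplus,\leq,0)$ such that: $\leq$ is a total order on $R$; $r\leq r\oplus s$ for all $r,s$; if $r\leq t$ and $s\leq u$ then $r\oplus s\leq t\oplus u$; $\oplus$ is commutative and associative; and $r\oplus 0=r$ for all $r$. The Archimedean complexity $\mathrm{arch}(R)$ of a distance monoid $R$ is the least $m$ such that for all $r_0\leq r_1\leq\cdots\leq r_m$ in $R$ one has $r_0\oplus r_1\oplus\cdots\oplus r_m=r_1\oplus\cdots\oplus r_m$ (and $\omega$ if no such $m$ exists). $DM(n,k)$ denotes the number of distance monoids (up to isomorphism of ordered monoids) with exactly $n$ non-zero elements and Archimedean complexity $k$. -}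

module Defs where

open import Data.Nat as ℕ using (ℕ; zero; suc; _+_; _*_; _∸_; _^_)
open import Data.Fin as Fin using (Fin; toℕ; inject₁)
open import Data.Fin.Properties as FinP using ()
open import Data.Vec as Vec using (Vec; []; _∷_; lookup)
open import Data.List as List using (List; []; _∷_; length; filter; cartesianProduct; allFin; upTo; concatMap; map)
open import Data.Nat.ListAction using (sum; product)
open import Data.List.Relation.Unary.All using (All; all?)
open import Data.Product using (_×_; _,_; proj₁; proj₂)
open import Relation.Nullary using (Dec; ¬_; ¬?)
open import Relation.Nullary.Decidable using (_×-dec_; _→-dec_)
open import Relation.Binary.PropositionalEquality using (_≡_)

vecsOver : {A : Set} → List A → (k : ℕ) → List (Vec A k)
vecsOver xs zero    = [] ∷ []
vecsOver xs (suc k) = concatMap (λ x → map (x ∷_) (vecsOver xs k)) xs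

-- A finite totally ordered set with N elements is, up to order-isomorphism,
-- Fin N with its standard order, and that order-isomorphism is unique.
-- Hence isomorphism classes of distance monoids with n non-zero elements
-- correspond bijectively to pairs (⊕-table, 0) on Fin (suc n) with the
-- standard order satisfying the axioms.

Table : ℕ → Set
Table N = Vec (Vec (Fin N) N) N

op : {N : ℕ} → Table N → Fin N → Fin N → Fin N
op t a b = lookup (lookup t a) b

module _ {N : ℕ} (t : Table N) (z : Fin N) where

  private
    _⊕_ = op t
    els = allFin N

  IsDistanceMonoid : Set
  IsDistanceMonoid =
      All (λ r → All (λ s → r Fin.≤ (r ⊕ s)) els) els
    × All (λ r → All (λ s → All (λ u → All (λ v →
          (r Fin.≤ u × s Fin.≤ v) → (r ⊕ s) Fin.≤ (u ⊕ v)) els) els) els) els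
    × All (λ r → All (λ s → (r ⊕ s) ≡ (s ⊕ r)) els) els
    × All (λ r → All (λ s → All (λ u → ((r ⊕ s) ⊕ u) ≡ (r ⊕ (s ⊕ u))) els) els) els
    × All (λ r → (r ⊕ z) ≡ r) els

  isDistanceMonoid? : Dec IsDistanceMonoid
  isDistanceMonoid? =
         all? (λ r → all? (λ s → r Fin.≤? (r ⊕ s)) els) els
    ×-dec all? (λ r → all? (λ s → all? (λ u → all? (λ v →
            ((r Fin.≤? u) ×-dec (s Fin.≤? v)) →-dec ((r ⊕ s) Fin.≤? (u ⊕ v))) els) els) els) els
    ×-dec all? (λ r → all? (λ s → (r ⊕ s) Fin.≟ (s ⊕ r)) els) els
    ×-dec all? (λ r → all? (λ s → all? (λ u → ((r ⊕ s) ⊕ u) Fin.≟ (r ⊕ (s ⊕ u))) els) els) els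
    ×-dec all? (λ r → (r ⊕ z) Fin.≟ r) els

  bigSum : {k : ℕ} → Vec (Fin N) k → Fin N
  bigSum = Vec.foldr _ _⊕_ z

  IsChain : {m : ℕ} → Vec (Fin N) (suc m) → Set
  IsChain {m} r = All (λ i → lookup r (inject₁ i) Fin.≤ lookup r (Fin.suc i)) (allFin m)

  isChain? : {m : ℕ} → (r : Vec (Fin N) (suc m)) → Dec (IsChain r)
  isChain? {m} r = all? (λ i → lookup r (inject₁ i) Fin.≤? lookup r (Fin.suc i)) (allFin m)

  ArchProp : ℕ → Set
  ArchProp m = All (λ (r : Vec (Fin N) (suc m)) →
                 IsChain r → bigSum r ≡ bigSum (Vec.tail r)) (vecsOver els (suc m))

  archProp? : (m : ℕ) → Dec (ArchProp m)
  archProp? m = all? (λ r → isChain? r →-dec (bigSum r Fin.≟ bigSum (Vec.tail r)))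
                     (vecsOver els (suc m))

  HasArch : ℕ → Set
  HasArch k = ArchProp k × All (λ j → ¬ ArchProp j) (upTo k)

  hasArch? : (k : ℕ) → Dec (HasArch k)
  hasArch? k = archProp? k ×-dec all? (λ j → ¬? (archProp? j)) (upTo k)

-- DM(n,k): number of distance monoids with exactly n non-zero elements
-- (carrier Fin (suc n)) and Archimedean complexity k
DM : ℕ → ℕ → ℕ
DM n k = length (filter (λ p → isDistanceMonoid? (proj₁ p) (proj₂ p)
                               ×-dec hasArch? (proj₁ p) (proj₂ p) k)
                        (cartesianProduct (vecsOver (vecsOver (allFin N) N) N) (allFin N)))
  where N = suc n

compositions : (n k : ℕ) → List (Vec ℕ k)
compositions n k =
  filter (λ v → Vec.sum v ℕ.≟ n) (vecsOver (List.map suc (upTo n)) k)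

weight : {k : ℕ} → Vec ℕ k → ℕ
weight {k} v = product (List.tabulate (λ (i : Fin k) → suc (toℕ i) ^ (lookup v i ∸ 1)))

rhs : ℕ → ℕ
rhs n = sum (map (λ k → sum (map weight (compositions n k))) (List.map suc (upTo (n ∸ 1))))

{-# OPTIONS --safe #-}
module Submission where

-- A distance monoid on {0, …, n} of Archimedean complexity at most 2 is determined by its
-- absorption threshold p v = max {x ≤ v ∣ x ⊕ v = v}: the map p is deflationary and idempotent
-- with p n = n, and for x ≤ y the sum x ⊕ y is the least w ≥ y with x ≤ p w.  Conversely every
-- such p defines a distance monoid of complexity at most 2, and the complexity is exactly 2
-- unless p is the identity (for n ≥ 1 it is never 0).  Listed in order, each value p v is either
-- v itself or one of the fixed points below v, and p n = n.  Cutting the list after each of the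
-- k fixed points in {1, …, n} gives a composition n₁ + ⋯ + n_k = n, and block j offers j choices
-- (0 and the j − 1 earlier fixed points) at each of its n_j − 1 non-fixed positions; k = n is the
-- identity.

open import Defs
open import Data.Bool using (if_then_else_)
open import Data.Fin as Fin using (Fin; toℕ; inject₁; fromℕ)
open import Data.Fin.Properties using (toℕ-injective; toℕ≤pred[n]; toℕ<n; toℕ-inject₁; toℕ-fromℕ)
open import Data.List as List
  using (List; []; _∷_; [_]; _++_; length; map; filter; concatMap; iterate; upTo; applyUpTo; allFin;
         cartesianProductWith; cartesianProduct)
import Data.List.Properties as List
open import Data.List.Membership.Propositional using (_∈_)
open import Data.List.Membership.Propositional.Properties
  using (∈-allFin; ∈-map⁺; ∈-map⁻; ∈-++⁺ˡ; ∈-++⁺ʳ; ∈-++⁻; ∈-filter⁺; ∈-filter⁻;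
         ∈-cartesianProductWith⁺; ∈-cartesianProductWith⁻; ∈-cartesianProduct⁺)
open import Data.List.Membership.Propositional.Properties.WithK using (unique∧set⇒bag)
open import Data.List.Relation.Binary.BagAndSetEquality using (∼bag⇒↭)
open import Data.List.Relation.Binary.Permutation.Propositional.Properties using (↭-length)
open import Data.List.Relation.Unary.All as All using (All; []; _∷_)
import Data.List.Relation.Unary.All.Properties as All
open import Data.List.Relation.Unary.AllPairs using ([]; _∷_)
open import Data.List.Relation.Unary.Any using (here; there)
open import Data.List.Relation.Unary.Unique.Propositional using (Unique)
import Data.List.Relation.Unary.Unique.Propositional.Properties as Unique
open import Data.Nat using (ℕ; zero; suc; _+_; _*_; _∸_; _^_; _≤_; _<_; z≤n; s≤s; _≤?_; _≟_; _⊔_; _⊓_)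
open import Data.Nat.ListAction using (sum; product)
open import Data.Nat.ListAction.Properties using (sum-++)
open import Data.Nat.Properties
open import Data.Product using (_×_; _,_; proj₁; proj₂)
open import Data.Sum using (_⊎_; inj₁; inj₂)
open import Data.Vec as Vec using (Vec; []; _∷_; lookup)
import Data.Vec.Properties as Vec
open import Function using (id; _∘_)
open import Function.Bundles using (_⇔_; mk⇔; Equivalence)
open import Relation.Binary.Definitions using (DecidableEquality)
open import Relation.Binary.PropositionalEquality hiding ([_])
open import Relation.Nullary using (Dec; yes; no; does; ¬_; ¬?; contradiction)
open import Relation.Nullary.Decidable using (_×-dec_)
open import Relation.Unary using (Decidable)
open import Algebra.Properties.Semiring.Sum +-*-semiring
  using (sum-syntax; sum⁺-syntax; ∑-comm; *-distribˡ-sum; sum-cong-≗; sum-init-last; sum-replicate-zero)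
  renaming (sum to ∑)

open ≡-Reasoning
open Equivalence using (to; from)

onlyIf : {P : Set} → Dec P → ℕ → ℕ
onlyIf d a = if does d then a else 0

module _ {P : Set} where

  onlyIf-yes : (d : Dec P) {a : ℕ} → P → onlyIf d a ≡ a
  onlyIf-yes (yes _) _ = refl
  onlyIf-yes (no ¬p) p = contradiction p ¬p

  onlyIf-no : (d : Dec P) {a : ℕ} → ¬ P → onlyIf d a ≡ 0
  onlyIf-no (yes p) ¬p = contradiction p ¬p
  onlyIf-no (no _)  _  = refl

  onlyIf-zero : (d : Dec P) {a : ℕ} → (P → a ≡ 0) → onlyIf d a ≡ 0
  onlyIf-zero (yes p) a≡0 = a≡0 p
  onlyIf-zero (no _)  _   = refl

  ∑-onlyIf : (d : Dec P) (c : ℕ) {m : ℕ} (f : Fin m → ℕ) →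
             ∑[ k < m ] (onlyIf d (c * f k)) ≡ onlyIf d (c * ∑[ k < m ] (f k))
  ∑-onlyIf (yes _) c f = sym (*-distribˡ-sum c f)
  ∑-onlyIf (no _)  c {m} f = sum-replicate-zero m

  sum-map-onlyIf : {A : Set} (d : Dec P) (c : ℕ) (h : A → ℕ) (xs : List A) →
                   sum (map (λ x → onlyIf d (c * h x)) xs) ≡ onlyIf d (c * sum (map h xs))
  sum-map-onlyIf (yes _) c h []       = sym (*-zeroʳ c)
  sum-map-onlyIf (yes p) c h (x ∷ xs) = begin
    c * h x + sum (map (λ x → c * h x) xs) ≡⟨ cong (c * h x +_) (sum-map-onlyIf (yes p) c h xs) ⟩
    c * h x + c * sum (map h xs)           ≡⟨ *-distribˡ-+ c (h x) _ ⟨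
    c * (h x + sum (map h xs))             ∎
  sum-map-onlyIf (no _)  c h []       = refl
  sum-map-onlyIf (no ¬p) c h (x ∷ xs) = sum-map-onlyIf (no ¬p) c h xs

∑-zero : ∀ {m} {f : Fin m → ℕ} → (∀ i → f i ≡ 0) → ∑ f ≡ 0
∑-zero {m} f≡0 = trans (sum-cong-≗ {m} f≡0) (sum-replicate-zero m)

∑-onlyIf-truncate : ∀ {s m} (g : ℕ → ℕ) → s ≤ m →
                    ∑[ i < m ] (onlyIf (suc (toℕ i) ≤? s) (g (toℕ i))) ≡ ∑[ i < s ] (g (toℕ i))
∑-onlyIf-truncate {zero} {m} g _     = ∑-zero {m} (λ i → onlyIf-no (suc (toℕ i) ≤? 0) {g (toℕ i)} (λ ()))
-- `suc (suc i) ≤? suc s` and `suc i ≤? s` compute to the same boolean.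
∑-onlyIf-truncate {suc s} g (s≤s s≤m) = cong (g 0 +_) (∑-onlyIf-truncate (g ∘ suc) s≤m)

onlyIf-+≟ : ∀ x a s c w → onlyIf (x + a ≟ s) (c * w) ≡ onlyIf (x ≤? s) (c * onlyIf (a ≟ s ∸ x) w)
onlyIf-+≟ x a s c w = split (x ≤? s) (a ≟ s ∸ x)
  where
  split : (x≤?s : Dec (x ≤ s)) (a≟ : Dec (a ≡ s ∸ x)) →
          onlyIf (x + a ≟ s) (c * w) ≡ onlyIf x≤?s (c * onlyIf a≟ w)
  split (yes x≤s) (yes a≡) = onlyIf-yes (x + a ≟ s) (trans (cong (x +_) a≡) (m+[n∸m]≡n x≤s))
  split (yes x≤s) (no a≢)  = trans
    (onlyIf-no (x + a ≟ s) (λ x+a≡s → a≢ (trans (sym (m+n∸m≡n x a)) (cong (_∸ x) x+a≡s))))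
    (sym (*-zeroʳ c))
  split (no x≰s)  _        = onlyIf-no (x + a ≟ s) (λ e → x≰s (subst (x ≤_) e (m≤m+n x a)))

sum-map-concatMap : {A B : Set} (h : B → ℕ) (g : A → List B) (xs : List A) →
                    sum (map h (concatMap g xs)) ≡ sum (map (λ x → sum (map h (g x))) xs)
sum-map-concatMap h g []       = refl
sum-map-concatMap h g (x ∷ xs) = begin
  sum (map h (g x ++ concatMap g xs))                         ≡⟨ cong sum (List.map-++ h (g x) _) ⟩
  sum (map h (g x) ++ map h (concatMap g xs))                 ≡⟨ sum-++ (map h (g x)) _ ⟩
  sum (map h (g x)) + sum (map h (concatMap g xs))            ≡⟨ cong (sum (map h (g x)) +_) (sum-map-concatMap h g xs) ⟩
  sum (map h (g x)) + sum (map (λ x → sum (map h (g x))) xs)  ∎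

sum-map-applyUpTo : (h f : ℕ → ℕ) (m : ℕ) → sum (map h (applyUpTo f m)) ≡ ∑[ i < m ] (h (f (toℕ i)))
sum-map-applyUpTo h f zero    = refl
sum-map-applyUpTo h f (suc m) = cong (h (f 0) +_) (sum-map-applyUpTo h (f ∘ suc) m)

sum-map-suc-upTo : (h : ℕ → ℕ) (m : ℕ) → sum (map h (map suc (upTo m))) ≡ ∑[ i < m ] (h (suc (toℕ i)))
sum-map-suc-upTo h m = trans (cong (sum ∘ map h) (List.map-applyUpTo id suc m)) (sum-map-applyUpTo h suc m)

sum-map-filter : {A : Set} {P : A → Set} (P? : Decidable P) (h : A → ℕ) (xs : List A) →
                 sum (map h (filter P? xs)) ≡ sum (map (λ x → onlyIf (P? x) (h x)) xs)
sum-map-filter P? h []       = refl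
sum-map-filter P? h (x ∷ xs) with P? x
... | yes _ = cong (h x +_) (sum-map-filter P? h xs)
... | no  _ = sum-map-filter P? h xs

extensionCount : ℕ → ℕ → ℕ
extensionCount zero          j = 1
extensionCount (suc zero)    j = 1
extensionCount (suc (suc m)) j = extensionCount (suc m) (suc j) + j * extensionCount (suc m) j

extensionCount-suc : ∀ s j →
  extensionCount (suc s) j ≡ ∑[ i ≤ s ] (j ^ toℕ i * extensionCount (s ∸ toℕ i) (suc j))
extensionCount-suc zero    j = refl
extensionCount-suc (suc s) j = cong₂ _+_ (sym (*-identityˡ _)) (begin
  j * extensionCount (suc s) j        ≡⟨ cong (j *_) (extensionCount-suc s j) ⟩
  j * ∑[ i ≤ s ] (j ^ toℕ i * c i)    ≡⟨ *-distribˡ-sum {suc s} j (λ i → j ^ toℕ i * c i) ⟩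
  ∑[ i ≤ s ] (j * (j ^ toℕ i * c i))  ≡⟨ sum-cong-≗ {suc s} (λ i → *-assoc j (j ^ toℕ i) (c i)) ⟨
  ∑[ i ≤ s ] (j ^ suc (toℕ i) * c i)  ∎)
  where
  c : Fin (suc s) → ℕ
  c i = extensionCount (s ∸ toℕ i) (suc j)

weightFrom : ℕ → ∀ {k} → Vec ℕ k → ℕ
weightFrom j {k} v = product (List.tabulate (λ (i : Fin k) → (j + toℕ i) ^ (lookup v i ∸ 1)))

weightFrom-∷ : ∀ j {k} x (v : Vec ℕ k) → weightFrom j (x ∷ v) ≡ j ^ (x ∸ 1) * weightFrom (suc j) v
weightFrom-∷ j x v = cong₂ (λ a b → a ^ (x ∸ 1) * b) (+-identityʳ j)
  (cong product (List.tabulate-cong (λ i → cong (λ a → a ^ (lookup v i ∸ 1)) (+-suc j (toℕ i)))))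

module _ (M : ℕ) where

  parts : List ℕ
  parts = map suc (upTo M)

  compositionWeights : (s k j : ℕ) → ℕ
  compositionWeights s k j = sum (map (λ v → onlyIf (Vec.sum v ≟ s) (weightFrom j v)) (vecsOver parts k))

  compositionWeights-suc : ∀ s k j → compositionWeights s (suc k) j ≡
    ∑[ i < M ] (onlyIf (suc (toℕ i) ≤? s) (j ^ toℕ i * compositionWeights (s ∸ suc (toℕ i)) k (suc j)))
  compositionWeights-suc s k j = begin
    sum (map h (concatMap (λ x → map (x ∷_) V) parts)) ≡⟨ sum-map-concatMap h (λ x → map (x ∷_) V) parts ⟩
    sum (map (λ x → sum (map h (map (x ∷_) V))) parts) ≡⟨ sum-map-suc-upTo (λ x → sum (map h (map (x ∷_) V))) M ⟩
    ∑[ i < M ] (sum (map h (map (suc (toℕ i) ∷_) V)))  ≡⟨ sum-cong-≗ {M} (λ i → first-part (toℕ i)) ⟩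
    ∑[ i < M ] (onlyIf (suc (toℕ i) ≤? s) (j ^ toℕ i * compositionWeights (s ∸ suc (toℕ i)) k (suc j))) ∎
    where
    V = vecsOver parts k
    h : Vec ℕ (suc k) → ℕ
    h v = onlyIf (Vec.sum v ≟ s) (weightFrom j v)
    first-part : ∀ i → sum (map h (map (suc i ∷_) V)) ≡
                 onlyIf (suc i ≤? s) (j ^ i * compositionWeights (s ∸ suc i) k (suc j))
    first-part i = begin
      sum (map h (map (suc i ∷_) V))                       ≡⟨ cong sum (List.map-∘ V) ⟨
      sum (map (h ∘ (suc i ∷_)) V)                         ≡⟨ cong sum (List.map-cong split V) ⟩
      sum (map (λ v → onlyIf (suc i ≤? s) (j ^ i * h′ v)) V) ≡⟨ sum-map-onlyIf (suc i ≤? s) (j ^ i) h′ V ⟩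
      onlyIf (suc i ≤? s) (j ^ i * sum (map h′ V))         ∎
      where
      h′ : Vec ℕ k → ℕ
      h′ v = onlyIf (Vec.sum v ≟ s ∸ suc i) (weightFrom (suc j) v)
      split : ∀ v → h (suc i ∷ v) ≡ onlyIf (suc i ≤? s) (j ^ i * h′ v)
      split v = trans (cong (onlyIf (suc i + Vec.sum v ≟ s)) (weightFrom-∷ j (suc i) v))
                      (onlyIf-+≟ (suc i) (Vec.sum v) s (j ^ i) (weightFrom (suc j) v))

  compositionWeights-vanish : ∀ {s k} j → s < k → compositionWeights s k j ≡ 0
  compositionWeights-vanish {s} {suc k} j (s≤s s≤k) = trans (compositionWeights-suc s k j) (∑-zero {M} λ i →
    onlyIf-zero (suc (toℕ i) ≤? s) λ i<s → trans
      (cong (j ^ toℕ i *_) (compositionWeights-vanish (suc j) (≤-trans (∸-monoʳ-< (s≤s z≤n) i<s) s≤k)))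
      (*-zeroʳ (j ^ toℕ i)))

  compositionWeights-diagonal : ∀ {s} j → s ≤ M → compositionWeights s s j ≡ 1
  compositionWeights-diagonal {zero}  j _   = refl
  compositionWeights-diagonal {suc s} j s<M = begin
    compositionWeights (suc s) (suc s) j
      ≡⟨ compositionWeights-suc (suc s) s j ⟩
    ∑[ i < M ] (onlyIf (suc (toℕ i) ≤? suc s) (j ^ toℕ i * compositionWeights (s ∸ toℕ i) s (suc j)))
      ≡⟨ ∑-onlyIf-truncate (λ i → j ^ i * compositionWeights (s ∸ i) s (suc j)) s<M ⟩
    1 * compositionWeights s s (suc j) + ∑[ i < s ] (j ^ suc (toℕ i) * compositionWeights (s ∸ suc (toℕ i)) s (suc j))
      ≡⟨ cong₂ _+_ (trans (*-identityˡ _) (compositionWeights-diagonal (suc j) (≤-trans (n≤1+n s) s<M)))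
                   (∑-zero {s} λ i → trans (cong (j ^ suc (toℕ i) *_)
                      (compositionWeights-vanish (suc j) (∸-monoʳ-< (s≤s z≤n) (toℕ<n i))))
                      (*-zeroʳ (j ^ suc (toℕ i)))) ⟩
    1 ∎

  ∑-compositionWeights : ∀ {s} K j → s ≤ K → s ≤ M →
                         ∑[ k ≤ K ] (compositionWeights s (toℕ k) j) ≡ extensionCount s j
  ∑-compositionWeights zero    j z≤n _ = refl
  ∑-compositionWeights {s} (suc K) j s≤1+K s≤M = begin
    w₀ + ∑[ k ≤ K ] (compositionWeights s (suc (toℕ k)) j)
      ≡⟨ cong (w₀ +_) (sum-cong-≗ {suc K} λ k → compositionWeights-suc s (toℕ k) j) ⟩
    w₀ + ∑[ k ≤ K ] ∑[ i < M ] (term (toℕ i) (toℕ k))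
      ≡⟨ cong (w₀ +_) (∑-comm {suc K} {M} (λ k i → term (toℕ i) (toℕ k))) ⟩
    w₀ + ∑[ i < M ] ∑[ k ≤ K ] (term (toℕ i) (toℕ k))
      ≡⟨ cong (w₀ +_) (sum-cong-≗ {M} λ i → inner-sum (toℕ i)) ⟩
    w₀ + ∑[ i < M ] (onlyIf (suc (toℕ i) ≤? s) (j ^ toℕ i * extensionCount (s ∸ suc (toℕ i)) (suc j)))
      ≡⟨ cong (w₀ +_) (∑-onlyIf-truncate (λ i → j ^ i * extensionCount (s ∸ suc i) (suc j)) s≤M) ⟩
    w₀ + ∑[ i < s ] (j ^ toℕ i * extensionCount (s ∸ suc (toℕ i)) (suc j))
      ≡⟨ split-first s ⟩
    extensionCount s j ∎
    where
    w₀ = compositionWeights s 0 j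
    term : ℕ → ℕ → ℕ
    term i k = onlyIf (suc i ≤? s) (j ^ i * compositionWeights (s ∸ suc i) k (suc j))
    inner-sum : ∀ i → ∑[ k ≤ K ] (term i (toℕ k)) ≡
                      onlyIf (suc i ≤? s) (j ^ i * extensionCount (s ∸ suc i) (suc j))
    inner-sum i = trans
      (∑-onlyIf (suc i ≤? s) (j ^ i) {suc K} (λ k → compositionWeights (s ∸ suc i) (toℕ k) (suc j)))
      (cong (λ c → onlyIf (suc i ≤? s) (j ^ i * c)) (∑-compositionWeights K (suc j)
        (≤-trans (∸-monoˡ-≤ (suc i) s≤1+K) (m∸n≤m K i)) (≤-trans (m∸n≤m s (suc i)) s≤M)))
    split-first : ∀ s → compositionWeights s 0 j + ∑[ i < s ] (j ^ toℕ i * extensionCount (s ∸ suc (toℕ i)) (suc j))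
                        ≡ extensionCount s j
    split-first zero    = refl
    split-first (suc s) = sym (extensionCount-suc s j)

rhs≡∑-compositionWeights : ∀ n → rhs n ≡ ∑[ k < n ∸ 1 ] (compositionWeights n n (suc (toℕ k)) 1)
rhs≡∑-compositionWeights n = trans (sum-map-suc-upTo _ (n ∸ 1)) (sum-cong-≗ {n ∸ 1} λ k →
  sum-map-filter (λ v → Vec.sum v ≟ n) weight (vecsOver (parts n) (suc (toℕ k))))

extensionCount≡rhs+1 : ∀ n → 1 ≤ n → extensionCount n 1 ≡ rhs n + 1
extensionCount≡rhs+1 (suc m) _ = begin
  extensionCount n 1
    ≡⟨ ∑-compositionWeights n n 1 ≤-refl ≤-refl ⟨
  ∑[ k < n ] (compositionWeights n n (suc (toℕ k)) 1)
    ≡⟨ sum-init-last {m} (λ k → compositionWeights n n (suc (toℕ k)) 1) ⟩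
  ∑[ k < m ] (compositionWeights n n (suc (toℕ (inject₁ k))) 1) + compositionWeights n n (suc (toℕ (fromℕ m))) 1
    ≡⟨ cong₂ _+_ (sum-cong-≗ {m} λ k → cong (λ i → compositionWeights n n (suc i) 1) (toℕ-inject₁ k))
                 (cong (λ i → compositionWeights n n (suc i) 1) (toℕ-fromℕ m)) ⟩
  ∑[ k < m ] (compositionWeights n n (suc (toℕ k)) 1) + compositionWeights n n n 1
    ≡⟨ cong₂ _+_ (sym (rhs≡∑-compositionWeights n)) (compositionWeights-diagonal n 1 ≤-refl) ⟩
  rhs n + 1 ∎
  where n = suc m

module _ {A : Set} where

  unique-set⇒length≡ : {xs ys : List A} → Unique xs → Unique ys → (∀ {x} → x ∈ xs ⇔ x ∈ ys) →
                       length xs ≡ length ys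
  unique-set⇒length≡ xs! ys! xs⇔ys = ↭-length (∼bag⇒↭ (unique∧set⇒bag xs! ys! xs⇔ys))

  length-filter-≢ : (_≟ₐ_ : DecidableEquality A) {a : A} {xs : List A} → Unique xs → a ∈ xs →
                    suc (length (filter (λ x → ¬? (x ≟ₐ a)) xs)) ≡ length xs
  length-filter-≢ _≟ₐ_ {a} {xs} xs! a∈xs = unique-set⇒length≡
    (All.map (λ x≢a a≡x → x≢a (sym a≡x)) (All.all-filter (λ x → ¬? (x ≟ₐ a)) xs) ∷ Unique.filter⁺ _ xs!)
    xs! (mk⇔ ⊆xs xs⊆)
    where
    ⊆xs : ∀ {x} → x ∈ a ∷ filter (λ x → ¬? (x ≟ₐ a)) xs → x ∈ xs
    ⊆xs (here refl) = a∈xs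
    ⊆xs (there x∈)  = proj₁ (∈-filter⁻ (λ x → ¬? (x ≟ₐ a)) x∈)
    xs⊆ : ∀ {x} → x ∈ xs → x ∈ a ∷ filter (λ x → ¬? (x ≟ₐ a)) xs
    xs⊆ {x} x∈ with x ≟ₐ a
    ... | yes refl = here refl
    ... | no  x≢a  = there (∈-filter⁺ (λ x → ¬? (x ≟ₐ a)) x∈ x≢a)

module _ {A B : Set} (f : A → B) (g : B → A) {xs : List A} {ys : List B} where

  unique-inverses⇒length≡ : Unique xs → Unique ys →
    (∀ {x} → x ∈ xs → f x ∈ ys × g (f x) ≡ x) →
    (∀ {y} → y ∈ ys → g y ∈ xs × f (g y) ≡ y) →
    length xs ≡ length ys
  unique-inverses⇒length≡ xs! ys! forth back = begin
    length xs         ≡⟨ List.length-map f xs ⟨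
    length (map f xs) ≡⟨ unique-set⇒length≡ fxs! ys! (mk⇔ ⊆ys ys⊆) ⟩
    length ys         ∎
    where
    g∘f≡id : map g (map f xs) ≡ xs
    g∘f≡id = trans (sym (List.map-∘ xs)) (List.map-id-local (All.tabulate (proj₂ ∘ forth)))
    fxs! : Unique (map f xs)
    fxs! = Unique.map⁻ (subst Unique (sym g∘f≡id) xs!)
    ⊆ys : ∀ {y} → y ∈ map f xs → y ∈ ys
    ⊆ys y∈ with ∈-map⁻ f y∈
    ... | x , x∈ , refl = proj₁ (forth x∈)
    ys⊆ : ∀ {y} → y ∈ ys → y ∈ map f xs
    ys⊆ y∈ = subst (_∈ map f xs) (proj₂ (back y∈)) (∈-map⁺ f (proj₁ (back y∈)))

concatMap-map≡cartesianProductWith : {A B C : Set} (f : A → B → C) (xs : List A) (ys : List B) →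
  concatMap (λ x → map (f x) ys) xs ≡ cartesianProductWith f xs ys
concatMap-map≡cartesianProductWith f []       ys = refl
concatMap-map≡cartesianProductWith f (x ∷ xs) ys = cong (map (f x) ys ++_) (concatMap-map≡cartesianProductWith f xs ys)

length-cartesianProductWith : {A B C : Set} (f : A → B → C) (xs : List A) (ys : List B) →
  length (cartesianProductWith f xs ys) ≡ length xs * length ys
length-cartesianProductWith f []       ys = refl
length-cartesianProductWith f (x ∷ xs) ys = begin
  length (map (f x) ys ++ cartesianProductWith f xs ys)        ≡⟨ List.length-++ (map (f x) ys) ⟩
  length (map (f x) ys) + length (cartesianProductWith f xs ys) ≡⟨ cong₂ _+_ (List.length-map (f x) ys)
                                                                          (length-cartesianProductWith f xs ys) ⟩
  length ys + length xs * length ys                              ∎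

module _ {A : Set} (xs : List A) where

  vecsOver-suc : ∀ k → vecsOver xs (suc k) ≡ cartesianProductWith _∷_ xs (vecsOver xs k)
  vecsOver-suc k = concatMap-map≡cartesianProductWith _∷_ xs (vecsOver xs k)

  ∈-vecsOver : (∀ x → x ∈ xs) → ∀ {k} (v : Vec A k) → v ∈ vecsOver xs k
  ∈-vecsOver ∈xs []      = here refl
  ∈-vecsOver ∈xs (x ∷ v) = subst (x ∷ v ∈_) (sym (vecsOver-suc _))
                                 (∈-cartesianProductWith⁺ _∷_ (∈xs x) (∈-vecsOver ∈xs v))

  vecsOver-unique : Unique xs → ∀ k → Unique (vecsOver xs k)
  vecsOver-unique xs! zero    = [] ∷ []
  vecsOver-unique xs! (suc k) = subst Unique (sym (vecsOver-suc k))
    (Unique.cartesianProductWith⁺ _∷_ Vec.∷-injective xs! (vecsOver-unique xs! k))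

-- The candidate value lists (p v, …, p (v + m − 1)) of a map p whose fixed points below v are
-- the elements of I: each entry is v itself or an element of I, and the last entry is fixed.
extensions : ℕ → ℕ → List ℕ → List (List ℕ)
extensions zero          v I = [ [] ]
extensions (suc zero)    v I = [ [ v ] ]
extensions (suc (suc m)) v I = map (v ∷_) (extensions (suc m) (suc v) (v ∷ I))
                            ++ cartesianProductWith _∷_ I (extensions (suc m) (suc v) I)

length-extensions : ∀ m v I → length (extensions m v I) ≡ extensionCount m (length I)
length-extensions zero          v I = refl
length-extensions (suc zero)    v I = refl
length-extensions (suc (suc m)) v I = begin
  length (map (v ∷_) E₁ ++ cartesianProductWith _∷_ I E₂)         ≡⟨ List.length-++ (map (v ∷_) E₁) ⟩
  length (map (v ∷_) E₁) + length (cartesianProductWith _∷_ I E₂) ≡⟨ cong₂ _+_ (List.length-map (v ∷_) E₁)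
                                                                              (length-cartesianProductWith _∷_ I E₂) ⟩
  length E₁ + length I * length E₂                                ≡⟨ cong₂ (λ a b → a + length I * b)
                                                                      (length-extensions (suc m) (suc v) (v ∷ I))
                                                                      (length-extensions (suc m) (suc v) I) ⟩
  extensionCount (suc (suc m)) (length I)                         ∎
  where
  E₁ = extensions (suc m) (suc v) (v ∷ I)
  E₂ = extensions (suc m) (suc v) I

extensions-unique : ∀ m {v I} → Unique I → All (_< v) I → Unique (extensions m v I)
extensions-unique zero          _  _   = [] ∷ []
extensions-unique (suc zero)    _  _   = [] ∷ []
extensions-unique (suc (suc m)) {v} {I} I! I<v = Unique.++⁺
  (Unique.map⁺ List.∷-injectiveʳ (extensions-unique (suc m) (All.map v≢ I<v ∷ I!) (n<1+n v ∷ I<1+v)))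
  (Unique.cartesianProductWith⁺ _∷_ List.∷-injective I! (extensions-unique (suc m) I! I<1+v))
  disjoint
  where
  v≢ : ∀ {e} → e < v → v ≢ e
  v≢ e<v v≡e = <-irrefl (sym v≡e) e<v
  I<1+v : All (_< suc v) I
  I<1+v = All.map m<n⇒m<1+n I<v
  disjoint : ∀ {qs} → ¬ (qs ∈ map (v ∷_) (extensions (suc m) (suc v) (v ∷ I))
                         × qs ∈ cartesianProductWith _∷_ I (extensions (suc m) (suc v) I))
  disjoint (∈E₁ , ∈E₂) with ∈-map⁻ (v ∷_) ∈E₁ | ∈-cartesianProductWith⁻ _∷_ I _ ∈E₂
  ... | _ , _ , refl | e , _ , e∈I , _ , refl = v≢ (All.lookup I<v e∈I) refl

∈-extensions⇒length : ∀ m {v I qs} → qs ∈ extensions m v I → length qs ≡ m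
∈-extensions⇒length zero          (here refl) = refl
∈-extensions⇒length (suc zero)    (here refl) = refl
∈-extensions⇒length (suc (suc m)) {v} {I} qs∈ with ∈-++⁻ (map (v ∷_) (extensions (suc m) (suc v) (v ∷ I))) qs∈
... | inj₁ ∈E₁ with ∈-map⁻ (v ∷_) ∈E₁
...   | _ , rs∈ , refl = cong suc (∈-extensions⇒length (suc m) rs∈)
∈-extensions⇒length (suc (suc m)) {v} {I} qs∈ | inj₂ ∈E₂ with ∈-cartesianProductWith⁻ _∷_ I _ ∈E₂
...   | _ , _ , _ , rs∈ , refl = cong suc (∈-extensions⇒length (suc m) rs∈)

∈-extensions-∷ : ∀ {m v I q qs} → (q ∷ qs) ∈ extensions (suc (suc m)) v I ⇔
  ((q ≡ v × qs ∈ extensions (suc m) (suc v) (v ∷ I)) ⊎ (q ∈ I × qs ∈ extensions (suc m) (suc v) I))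
∈-extensions-∷ {m} {v} {I} {q} {qs} = mk⇔ to′ from′
  where
  to′ : (q ∷ qs) ∈ extensions (suc (suc m)) v I →
        (q ≡ v × qs ∈ extensions (suc m) (suc v) (v ∷ I)) ⊎ (q ∈ I × qs ∈ extensions (suc m) (suc v) I)
  to′ q∷qs∈ with ∈-++⁻ (map (v ∷_) (extensions (suc m) (suc v) (v ∷ I))) q∷qs∈
  ... | inj₁ ∈E₁ with ∈-map⁻ (v ∷_) ∈E₁
  ...   | _ , qs∈ , refl = inj₁ (refl , qs∈)
  to′ q∷qs∈ | inj₂ ∈E₂ with ∈-cartesianProductWith⁻ _∷_ I _ ∈E₂
  ...   | _ , _ , q∈ , qs∈ , refl = inj₂ (q∈ , qs∈)
  from′ : (q ≡ v × qs ∈ extensions (suc m) (suc v) (v ∷ I)) ⊎ (q ∈ I × qs ∈ extensions (suc m) (suc v) I) →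
          (q ∷ qs) ∈ extensions (suc (suc m)) v I
  from′ (inj₁ (refl , qs∈)) = ∈-++⁺ˡ (∈-map⁺ (v ∷_) qs∈)
  from′ (inj₂ (q∈ , qs∈))   = ∈-++⁺ʳ _ (∈-cartesianProductWith⁺ _∷_ q∈ qs∈)

module _ (p : ℕ → ℕ) where

  FixedBelow : ℕ → List ℕ → Set
  FixedBelow v I = ∀ {e} → e ∈ I ⇔ (e < v × p e ≡ e)

  Stable : ℕ → Set
  Stable w = p w ≤ w × p (p w) ≡ p w

  fixed⇒stable : ∀ {w} → p w ≡ w → Stable w
  fixed⇒stable pw≡w = ≤-reflexive pw≡w , cong p pw≡w

  fixedBelow-fixed : ∀ {v I} → p v ≡ v → FixedBelow v I → FixedBelow (suc v) (v ∷ I)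
  fixedBelow-fixed {v} pv≡v I≡fixed = mk⇔
    (λ { (here refl) → n<1+n v , pv≡v
       ; (there e∈I) → let e<v , pe≡e = to I≡fixed e∈I in m<n⇒m<1+n e<v , pe≡e })
    (λ (e<1+v , pe≡e) → case (m≤n⇒m<n∨m≡n (≤-pred e<1+v)) pe≡e)
    where
    case : ∀ {e} → e < v ⊎ e ≡ v → p e ≡ e → e ∈ v ∷ _
    case (inj₁ e<v) pe≡e = there (from I≡fixed (e<v , pe≡e))
    case (inj₂ refl) _   = here refl

  fixedBelow-moved : ∀ {v I} → p v ≢ v → FixedBelow v I → FixedBelow (suc v) I
  fixedBelow-moved {v} pv≢v I≡fixed = mk⇔
    (λ e∈I → let e<v , pe≡e = to I≡fixed e∈I in m<n⇒m<1+n e<v , pe≡e)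
    (λ (e<1+v , pe≡e) → case (m≤n⇒m<n∨m≡n (≤-pred e<1+v)) pe≡e)
    where
    case : ∀ {e} → e < v ⊎ e ≡ v → p e ≡ e → e ∈ _
    case (inj₁ e<v) pe≡e = from I≡fixed (e<v , pe≡e)
    case (inj₂ refl) pv≡v = contradiction pv≡v pv≢v

  module _ (t : ℕ) where

    RetractionFrom : ℕ → Set
    RetractionFrom v = (∀ {w} → v ≤ w → w ≤ t → Stable w) × p t ≡ t

    retractionFrom-step : ∀ {v} → v < t → RetractionFrom v ⇔ (Stable v × RetractionFrom (suc v))
    retractionFrom-step {v} v<t = mk⇔
      (λ (stable , top) → stable ≤-refl (<⇒≤ v<t) , (λ v<w → stable (<⇒≤ v<w)) , top)
      (λ (stable-v , stable , top) → stable′ stable-v stable , top)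
      where
      stable′ : Stable v → (∀ {w} → suc v ≤ w → w ≤ t → Stable w) → ∀ {w} → v ≤ w → w ≤ t → Stable w
      stable′ stable-v stable v≤w w≤t with m≤n⇒m<n∨m≡n v≤w
      ... | inj₁ v<w  = stable v<w w≤t
      ... | inj₂ refl = stable-v

    ∈-extensions⇔ : ∀ m {v I} → v + m ≡ t → FixedBelow v I →
      map p (iterate suc v (suc m)) ∈ extensions (suc m) v I ⇔ RetractionFrom v
    ∈-extensions⇔ zero {v} v+0≡t _ with trans (sym (+-identityʳ v)) v+0≡t
    ... | refl = mk⇔
      (λ { (here pv∷[]≡v∷[]) → let pv≡v = List.∷-injectiveˡ pv∷[]≡v∷[] in
             (λ v≤w w≤v → subst Stable (≤-antisym v≤w w≤v) (fixed⇒stable pv≡v)) , pv≡v })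
      (λ (_ , pv≡v) → here (cong [_] pv≡v))
    ∈-extensions⇔ (suc m) {v} {I} v+1+m≡t I≡fixed with p v ≟ v
    ... | yes pv≡v = mk⇔
      (λ ∈E → case (to (∈-extensions-∷ {m}) ∈E))
      (λ R → from (∈-extensions-∷ {m}) (inj₁ (pv≡v , from IH (proj₂ (to step R)))))
      where
      rest = map p (iterate suc (suc v) (suc m))
      IH = ∈-extensions⇔ m (trans (sym (+-suc v m)) v+1+m≡t) (fixedBelow-fixed pv≡v I≡fixed)
      step = retractionFrom-step (subst (v <_) v+1+m≡t (m<m+n v (s≤s z≤n)))
      case : (p v ≡ v × rest ∈ extensions (suc m) (suc v) (v ∷ I)) ⊎
             (p v ∈ I × rest ∈ extensions (suc m) (suc v) I) → RetractionFrom v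
      case (inj₁ (_ , rest∈)) = from step (fixed⇒stable pv≡v , to IH rest∈)
      case (inj₂ (pv∈I , _))  = contradiction pv≡v (<⇒≢ (proj₁ (to I≡fixed pv∈I)))
    ... | no pv≢v = mk⇔
      (λ ∈E → case (to (∈-extensions-∷ {m}) ∈E))
      (λ R → let (pv≤v , ppv≡pv) , R′ = to step R in
             from (∈-extensions-∷ {m}) (inj₂ (from I≡fixed (≤∧≢⇒< pv≤v pv≢v , ppv≡pv) , from IH R′)))
      where
      rest = map p (iterate suc (suc v) (suc m))
      IH = ∈-extensions⇔ m (trans (sym (+-suc v m)) v+1+m≡t) (fixedBelow-moved pv≢v I≡fixed)
      step = retractionFrom-step (subst (v <_) v+1+m≡t (m<m+n v (s≤s z≤n)))
      case : (p v ≡ v × rest ∈ extensions (suc m) (suc v) (v ∷ I)) ⊎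
             (p v ∈ I × rest ∈ extensions (suc m) (suc v) I) → RetractionFrom v
      case (inj₁ (pv≡v , _))     = contradiction pv≡v pv≢v
      case (inj₂ (pv∈I , rest∈)) = let pv<v , ppv≡pv = to I≡fixed pv∈I in
                                   from step ((<⇒≤ pv<v , ppv≡pv) , to IH rest∈)

record IsDeflationaryRetraction (n : ℕ) (p : ℕ → ℕ) : Set where
  field
    deflationary : ∀ {w} → w ≤ n → p w ≤ w
    idempotent   : ∀ {w} → w ≤ n → p (p w) ≡ p w
    fixes-top    : p n ≡ n

nth : List ℕ → ℕ → ℕ
nth []       _       = 0
nth (x ∷ xs) zero    = x
nth (x ∷ xs) (suc i) = nth xs i

code : ℕ → (ℕ → ℕ) → List ℕ
code n p = map p (iterate suc 0 (suc n))

map-iterate-suc : (f : ℕ → ℕ) (v m : ℕ) → map f (iterate suc (suc v) m) ≡ map (f ∘ suc) (iterate suc v m)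
map-iterate-suc f v zero    = refl
map-iterate-suc f v (suc m) = cong (f (suc v) ∷_) (map-iterate-suc f (suc v) m)

code-suc : ∀ n p → code (suc n) p ≡ p 0 ∷ code n (p ∘ suc)
code-suc n p = cong (p 0 ∷_) (map-iterate-suc p 0 (suc n))

code-cong : ∀ n {p q} → (∀ {w} → w ≤ n → p w ≡ q w) → code n p ≡ code n q
code-cong zero    p≡q = cong [_] (p≡q z≤n)
code-cong (suc n) {p} {q} p≡q = begin
  code (suc n) p          ≡⟨ code-suc n p ⟩
  p 0 ∷ code n (p ∘ suc)  ≡⟨ cong₂ _∷_ (p≡q z≤n) (code-cong n (p≡q ∘ s≤s)) ⟩
  q 0 ∷ code n (q ∘ suc)  ≡⟨ code-suc n q ⟨
  code (suc n) q          ∎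

nth-code : ∀ n p {w} → w ≤ n → nth (code n p) w ≡ p w
nth-code zero    p z≤n = refl
nth-code (suc n) p {w} w≤1+n rewrite code-suc n p with w≤1+n
... | z≤n     = refl
... | s≤s w≤n = nth-code n (p ∘ suc) w≤n

code-nth : ∀ n ps → length ps ≡ suc n → code n (nth ps) ≡ ps
code-nth zero    (x ∷ [])     _   = refl
code-nth (suc n) (x ∷ y ∷ ys) len = trans (code-suc n (nth (x ∷ y ∷ ys)))
                                          (cong (x ∷_) (code-nth n (y ∷ ys) (suc-injective len)))

retractionCodes : ℕ → List (List ℕ)
retractionCodes n = extensions (suc n) 0 []

code∈retractionCodes⇔ : ∀ {n p} → code n p ∈ retractionCodes n ⇔ IsDeflationaryRetraction n p
code∈retractionCodes⇔ {n} {p} = mk⇔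
  (λ ∈codes → toRetraction (to (∈-extensions⇔ p n n refl none-below-0) ∈codes))
  (λ R → from (∈-extensions⇔ p n n refl none-below-0) (fromRetraction R))
  where
  none-below-0 : FixedBelow p 0 []
  none-below-0 = mk⇔ (λ ()) (λ ())
  toRetraction : RetractionFrom p n 0 → IsDeflationaryRetraction n p
  toRetraction (stable , top) = record
    { deflationary = λ w≤n → proj₁ (stable z≤n w≤n)
    ; idempotent   = λ w≤n → proj₂ (stable z≤n w≤n)
    ; fixes-top    = top }
  fromRetraction : IsDeflationaryRetraction n p → RetractionFrom p n 0
  fromRetraction R = (λ _ w≤n → deflationary w≤n , idempotent w≤n) , fixes-top
    where open IsDeflationaryRetraction R

∈-retractionCodes⇒≡code : ∀ {n ps} → ps ∈ retractionCodes n → ps ≡ code n (nth ps)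
∈-retractionCodes⇒≡code {n} {ps} ps∈ = sym (code-nth n ps (∈-extensions⇒length (suc n) ps∈))

id-isDeflationaryRetraction : ∀ n → IsDeflationaryRetraction n id
id-isDeflationaryRetraction n = record { deflationary = λ _ → ≤-refl ; idempotent = λ _ → refl ; fixes-top = refl }

isNonIdentity? : ∀ n ps → Dec (ps ≢ code n id)
isNonIdentity? n ps = ¬? (List.≡-dec _≟_ ps (code n id))

nonIdentityCodes : ℕ → List (List ℕ)
nonIdentityCodes n = filter (isNonIdentity? n) (retractionCodes n)

nonIdentityCodes-unique : ∀ n → Unique (nonIdentityCodes n)
nonIdentityCodes-unique n = Unique.filter⁺ (isNonIdentity? n) (extensions-unique (suc n) [] [])

length-nonIdentityCodes : ∀ n → 1 ≤ n → length (nonIdentityCodes n) ≡ rhs n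
length-nonIdentityCodes n@(suc m) 1≤n = suc-injective (begin
  suc (length (nonIdentityCodes n)) ≡⟨ length-filter-≢ (List.≡-dec _≟_) (extensions-unique (suc n) [] [])
                                          (from code∈retractionCodes⇔ (id-isDeflationaryRetraction n)) ⟩
  length (retractionCodes n)        ≡⟨ length-extensions (suc n) 0 [] ⟩
  extensionCount n 1 + 0            ≡⟨ +-identityʳ _ ⟩
  extensionCount n 1                ≡⟨ extensionCount≡rhs+1 n 1≤n ⟩
  rhs n + 1                         ≡⟨ +-comm (rhs n) 1 ⟩
  suc (rhs n)                       ∎)

module _ {P : ℕ → Set} (P? : Decidable P) where

  -- the least w ∈ [lo, lo + k] with P w, and lo + k if there is none
  minFrom : ℕ → ℕ → ℕ
  minFrom lo zero    = lo
  minFrom lo (suc k) with P? lo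
  ... | yes _ = lo
  ... | no  _ = minFrom (suc lo) k

  minFrom-≥ : ∀ lo k → lo ≤ minFrom lo k
  minFrom-≥ lo zero    = ≤-refl
  minFrom-≥ lo (suc k) with P? lo
  ... | yes _ = ≤-refl
  ... | no  _ = ≤-trans (n≤1+n lo) (minFrom-≥ (suc lo) k)

  minFrom-≤ : ∀ lo k → minFrom lo k ≤ lo + k
  minFrom-≤ lo zero    = ≤-reflexive (sym (+-identityʳ lo))
  minFrom-≤ lo (suc k) with P? lo
  ... | yes _ = m≤m+n lo (suc k)
  ... | no  _ = ≤-trans (minFrom-≤ (suc lo) k) (≤-reflexive (sym (+-suc lo k)))

  minFrom-satisfies : ∀ lo k → P (lo + k) → P (minFrom lo k)
  minFrom-satisfies lo zero    P[lo+0] = subst P (+-identityʳ lo) P[lo+0]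
  minFrom-satisfies lo (suc k) P[lo+k] with P? lo
  ... | yes P[lo] = P[lo]
  ... | no  _     = minFrom-satisfies (suc lo) k (subst P (+-suc lo k) P[lo+k])

  minFrom-minimal : ∀ lo k {w} → lo ≤ w → P w → minFrom lo k ≤ w
  minFrom-minimal lo zero    lo≤w _ = lo≤w
  minFrom-minimal lo (suc k) lo≤w Pw with P? lo
  ... | yes _    = lo≤w
  ... | no  ¬Plo with m≤n⇒m<n∨m≡n lo≤w
  ...   | inj₁ lo<w = minFrom-minimal (suc lo) k lo<w Pw
  ...   | inj₂ refl = contradiction Pw ¬Plo

  -- the greatest x ≤ v with P x, and 0 if there is none
  maxUpTo : ℕ → ℕ
  maxUpTo zero    = zero
  maxUpTo (suc v) with P? (suc v)
  ... | yes _ = suc v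
  ... | no  _ = maxUpTo v

  maxUpTo-≤ : ∀ v → maxUpTo v ≤ v
  maxUpTo-≤ zero    = z≤n
  maxUpTo-≤ (suc v) with P? (suc v)
  ... | yes _ = ≤-refl
  ... | no  _ = m≤n⇒m≤1+n (maxUpTo-≤ v)

  maxUpTo-satisfies : P 0 → ∀ v → P (maxUpTo v)
  maxUpTo-satisfies P0 zero    = P0
  maxUpTo-satisfies P0 (suc v) with P? (suc v)
  ... | yes P[1+v] = P[1+v]
  ... | no  _      = maxUpTo-satisfies P0 v

  maxUpTo-maximal : ∀ {x} v → x ≤ v → P x → x ≤ maxUpTo v
  maxUpTo-maximal zero    x≤0   _  = x≤0
  maxUpTo-maximal (suc v) x≤1+v Px with P? (suc v)
  ... | yes _       = x≤1+v
  ... | no  ¬P[1+v] with m≤n⇒m<n∨m≡n x≤1+v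
  ...   | inj₁ x<1+v = maxUpTo-maximal v (≤-pred x<1+v) Px
  ...   | inj₂ refl  = contradiction Px ¬P[1+v]

record IsBoundedDistanceMonoid (n : ℕ) (_∙_ : ℕ → ℕ → ℕ) : Set where
  field
    ∙-closed    : ∀ {a b} → a ≤ n → b ≤ n → a ∙ b ≤ n
    ≤-∙         : ∀ {a b} → a ≤ n → b ≤ n → a ≤ a ∙ b
    ∙-mono      : ∀ {a b c d} → a ≤ c → b ≤ d → c ≤ n → d ≤ n → a ∙ b ≤ c ∙ d
    ∙-comm      : ∀ {a b} → a ≤ n → b ≤ n → a ∙ b ≡ b ∙ a
    ∙-assoc     : ∀ {a b c} → a ≤ n → b ≤ n → c ≤ n → (a ∙ b) ∙ c ≡ a ∙ (b ∙ c)
    ∙-identityʳ : ∀ {a} → a ≤ n → a ∙ 0 ≡ a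

AbsorbsChains : ℕ → (ℕ → ℕ → ℕ) → Set
AbsorbsChains n _∙_ = ∀ {a b c} → a ≤ b → b ≤ c → c ≤ n → a ∙ (b ∙ c) ≡ b ∙ c

record IsThreshold (n : ℕ) (_∙_ : ℕ → ℕ → ℕ) (p : ℕ → ℕ) : Set where
  field
    deflationary : ∀ {w} → w ≤ n → p w ≤ w
    absorbs⇔     : ∀ {x v} → x ≤ v → v ≤ n → (x ∙ v ≡ v ⇔ x ≤ p v)

module _ (n : ℕ) (p : ℕ → ℕ) where

  absorber : ℕ → ℕ → ℕ
  absorber y x = minFrom (λ w → x ≤? p w) y (n ∸ y)

  retractionOp : ℕ → ℕ → ℕ
  retractionOp x y = absorber (x ⊔ y) (x ⊓ y)

module RetractionMonoid {n : ℕ} {p : ℕ → ℕ} (R : IsDeflationaryRetraction n p) where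

  open IsDeflationaryRetraction R

  infixl 6 _⊕_
  _⊕_ : ℕ → ℕ → ℕ
  _⊕_ = retractionOp n p

  absorber-≥ : ∀ y x → y ≤ absorber n p y x
  absorber-≥ y x = minFrom-≥ (λ w → x ≤? p w) y (n ∸ y)

  absorber-≤ : ∀ {y} x → y ≤ n → absorber n p y x ≤ n
  absorber-≤ {y} x y≤n = ≤-trans (minFrom-≤ (λ w → x ≤? p w) y (n ∸ y)) (≤-reflexive (m+[n∸m]≡n y≤n))

  absorber-absorbs : ∀ {y x} → y ≤ n → x ≤ n → x ≤ p (absorber n p y x)
  absorber-absorbs {y} {x} y≤n x≤n = minFrom-satisfies (λ w → x ≤? p w) y (n ∸ y)
    (subst (λ w → x ≤ p w) (sym (m+[n∸m]≡n y≤n)) (subst (x ≤_) (sym fixes-top) x≤n))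

  absorber-minimal : ∀ {y x w} → y ≤ w → x ≤ p w → absorber n p y x ≤ w
  absorber-minimal {y} {x} y≤w x≤pw = minFrom-minimal (λ w → x ≤? p w) y (n ∸ y) y≤w x≤pw

  absorber-mono : ∀ {y x y′ x′} → y ≤ y′ → x ≤ x′ → y′ ≤ n → x′ ≤ n →
                  absorber n p y x ≤ absorber n p y′ x′
  absorber-mono {y′ = y′} {x′} y≤y′ x≤x′ y′≤n x′≤n = absorber-minimal
    (≤-trans y≤y′ (absorber-≥ y′ x′)) (≤-trans x≤x′ (absorber-absorbs y′≤n x′≤n))

  absorber-fixed : ∀ {y x} → x ≤ p y → absorber n p y x ≡ y
  absorber-fixed {y} {x} x≤py = ≤-antisym (absorber-minimal ≤-refl x≤py) (absorber-≥ y x)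

  absorber-unique : ∀ {y x r} → y ≤ n → x ≤ n → y ≤ r → x ≤ p r →
                    (∀ {w} → y ≤ w → w ≤ n → x ≤ p w → r ≤ w) → absorber n p y x ≡ r
  absorber-unique {y} {x} y≤n x≤n y≤r x≤pr r-minimal = ≤-antisym (absorber-minimal y≤r x≤pr)
    (r-minimal (absorber-≥ y x) (absorber-≤ x y≤n) (absorber-absorbs y≤n x≤n))

  ⊕-sorted : ∀ {x y} → x ≤ y → x ⊕ y ≡ absorber n p y x
  ⊕-sorted x≤y = cong₂ (absorber n p) (m≤n⇒m⊔n≡n x≤y) (m≤n⇒m⊓n≡m x≤y)

  ⊕-comm : ∀ x y → x ⊕ y ≡ y ⊕ x
  ⊕-comm x y = cong₂ (absorber n p) (⊔-comm x y) (⊓-comm x y)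

  ⊕-absorbs⇔ : ∀ {x v} → x ≤ v → v ≤ n → (x ⊕ v ≡ v ⇔ x ≤ p v)
  ⊕-absorbs⇔ {x} {v} x≤v v≤n = mk⇔
    (λ x⊕v≡v → subst (λ w → x ≤ p w) (trans (sym (⊕-sorted x≤v)) x⊕v≡v)
                     (absorber-absorbs v≤n (≤-trans x≤v v≤n)))
    (λ x≤pv → trans (⊕-sorted x≤v) (absorber-fixed x≤pv))

  -- By commutativity, (a ⊕ b) ⊕ c only depends on which of a, b, c is added last; for a sorted
  -- triple x ≤ y ≤ z all three choices give y ⊕ z, which yields associativity.
  module _ {x y z} (x≤y : x ≤ y) (y≤z : y ≤ z) (z≤n : z ≤ n) where

    private
      y≤n = ≤-trans y≤z z≤n
      s   = absorber n p z y
      z≤s = absorber-≥ z y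
      s≤n = absorber-≤ y z≤n
      y≤ps : y ≤ p s
      y≤ps = absorber-absorbs z≤n y≤n

    [y⊕z]⊕x : (y ⊕ z) ⊕ x ≡ y ⊕ z
    [y⊕z]⊕x = begin
      (y ⊕ z) ⊕ x  ≡⟨ cong (_⊕ x) (⊕-sorted y≤z) ⟩
      s ⊕ x        ≡⟨ ⊕-comm s x ⟩
      x ⊕ s        ≡⟨ ⊕-sorted (≤-trans (≤-trans x≤y y≤z) z≤s) ⟩
      absorber n p s x ≡⟨ absorber-fixed (≤-trans x≤y y≤ps) ⟩
      s            ≡⟨ ⊕-sorted y≤z ⟨
      y ⊕ z        ∎

    [x⊕z]⊕y : (x ⊕ z) ⊕ y ≡ y ⊕ z
    [x⊕z]⊕y = begin
      (x ⊕ z) ⊕ y      ≡⟨ cong (_⊕ y) (⊕-sorted (≤-trans x≤y y≤z)) ⟩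
      t ⊕ y            ≡⟨ ⊕-comm t y ⟩
      y ⊕ t            ≡⟨ ⊕-sorted (≤-trans y≤z (absorber-≥ z x)) ⟩
      absorber n p t y ≡⟨ ≤-antisym (absorber-minimal t≤s y≤ps)
                                    (absorber-mono (absorber-≥ z x) ≤-refl t≤n y≤n) ⟩
      s                ≡⟨ ⊕-sorted y≤z ⟨
      y ⊕ z            ∎
      where
      t   = absorber n p z x
      t≤n = absorber-≤ x z≤n
      t≤s : t ≤ s
      t≤s = absorber-mono ≤-refl x≤y z≤n y≤n

    [x⊕y]⊕z : (x ⊕ y) ⊕ z ≡ y ⊕ z
    [x⊕y]⊕z = begin
      (x ⊕ y) ⊕ z  ≡⟨ cong (_⊕ z) (⊕-sorted x≤y) ⟩
      u ⊕ z        ≡⟨ u⊕z≡s (≤-total u z) ⟩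
      s            ≡⟨ ⊕-sorted y≤z ⟨
      y ⊕ z        ∎
      where
      u   = absorber n p y x
      y≤u = absorber-≥ y x
      u≤n = absorber-≤ x y≤n
      u≤ps : u ≤ p s
      u≤ps = absorber-minimal y≤ps (≤-trans (≤-trans x≤y y≤ps) (≤-reflexive (sym (idempotent s≤n))))
      u⊕z≡s : u ≤ z ⊎ z ≤ u → u ⊕ z ≡ s
      u⊕z≡s (inj₁ u≤z) = trans (⊕-sorted u≤z)
        (≤-antisym (absorber-minimal z≤s u≤ps) (absorber-mono ≤-refl y≤u z≤n u≤n))
      u⊕z≡s (inj₂ z≤u) = trans (⊕-comm u z) (trans (⊕-sorted z≤u)
        (≤-antisym (absorber-minimal (≤-trans u≤ps (deflationary s≤n)) (≤-trans z≤u u≤ps))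
                   (absorber-mono z≤u y≤z u≤n z≤n)))

  ⊕-assoc : ∀ {a b c} → a ≤ n → b ≤ n → c ≤ n → (a ⊕ b) ⊕ c ≡ a ⊕ (b ⊕ c)
  ⊕-assoc {a} {b} {c} a≤n b≤n c≤n =
    trans (rotate (≤-total a b) (≤-total b c) (≤-total a c)) (⊕-comm (b ⊕ c) a)
    where
    swap : ∀ d e f → (d ⊕ e) ⊕ f ≡ (e ⊕ d) ⊕ f
    swap d e f = cong (_⊕ f) (⊕-comm d e)
    rotate : a ≤ b ⊎ b ≤ a → b ≤ c ⊎ c ≤ b → a ≤ c ⊎ c ≤ a → (a ⊕ b) ⊕ c ≡ (b ⊕ c) ⊕ a
    rotate (inj₁ a≤b) (inj₁ b≤c) _          = trans ([x⊕y]⊕z a≤b b≤c c≤n) (sym ([y⊕z]⊕x a≤b b≤c c≤n))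
    rotate (inj₁ a≤b) (inj₂ c≤b) (inj₁ a≤c) = trans ([x⊕z]⊕y a≤c c≤b b≤n)
                                                     (sym (trans (swap b c a) ([y⊕z]⊕x a≤c c≤b b≤n)))
    rotate (inj₁ a≤b) (inj₂ c≤b) (inj₂ c≤a) = trans ([y⊕z]⊕x c≤a a≤b b≤n)
                                                     (sym (trans (swap b c a) ([x⊕z]⊕y c≤a a≤b b≤n)))
    rotate (inj₂ b≤a) _          (inj₁ a≤c) = trans (trans (swap a b c) ([x⊕y]⊕z b≤a a≤c c≤n))
                                                     (sym ([x⊕z]⊕y b≤a a≤c c≤n))
    rotate (inj₂ b≤a) (inj₁ b≤c) (inj₂ c≤a) = trans (trans (swap a b c) ([x⊕z]⊕y b≤c c≤a a≤n))
                                                     (sym ([x⊕y]⊕z b≤c c≤a a≤n))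
    rotate (inj₂ b≤a) (inj₂ c≤b) (inj₂ c≤a) = trans (trans (swap a b c) ([y⊕z]⊕x c≤b b≤a a≤n))
                                                     (sym (trans (swap b c a) ([x⊕y]⊕z c≤b b≤a a≤n)))

  isBoundedDistanceMonoid : IsBoundedDistanceMonoid n _⊕_
  isBoundedDistanceMonoid = record
    { ∙-closed    = λ {a} {b} a≤n b≤n → absorber-≤ (a ⊓ b) (⊔-lub a≤n b≤n)
    ; ≤-∙         = λ {a} {b} _ _ → ≤-trans (m≤m⊔n a b) (absorber-≥ (a ⊔ b) (a ⊓ b))
    ; ∙-mono      = λ {a} {b} {c} {d} a≤c b≤d c≤n d≤n → absorber-mono
                      (⊔-mono-≤ a≤c b≤d) (⊓-mono-≤ a≤c b≤d) (⊔-lub c≤n d≤n) (≤-trans (m⊓n≤m c d) c≤n)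
    ; ∙-comm      = λ {a} {b} _ _ → ⊕-comm a b
    ; ∙-assoc     = ⊕-assoc
    ; ∙-identityʳ = λ {a} _ → trans (cong₂ (absorber n p) (⊔-identityʳ a) (⊓-zeroʳ a)) (absorber-fixed z≤n)
    }

  absorbsChains : AbsorbsChains n _⊕_
  absorbsChains {a} {b} {c} a≤b b≤c c≤n = trans (⊕-comm a (b ⊕ c)) ([y⊕z]⊕x a≤b b≤c c≤n)

  isThreshold : IsThreshold n _⊕_ p
  isThreshold = record { deflationary = deflationary ; absorbs⇔ = ⊕-absorbs⇔ }

threshold : (ℕ → ℕ → ℕ) → ℕ → ℕ
threshold _∙_ v = maxUpTo (λ x → x ∙ v ≟ v) v

module _ {n : ℕ} {_∙_ _∙′_ : ℕ → ℕ → ℕ} {p : ℕ → ℕ} where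

  IsThreshold-resp-op : (∀ {a b} → a ≤ n → b ≤ n → a ∙ b ≡ a ∙′ b) →
                        IsThreshold n _∙_ p → IsThreshold n _∙′_ p
  IsThreshold-resp-op ∙≡∙′ T = record
    { deflationary = deflationary
    ; absorbs⇔     = λ {x} {v} x≤v v≤n → let x∙v≡x∙′v = ∙≡∙′ (≤-trans x≤v v≤n) v≤n in mk⇔
        (λ x∙′v≡v → to (absorbs⇔ x≤v v≤n) (trans x∙v≡x∙′v x∙′v≡v))
        (λ x≤pv → trans (sym x∙v≡x∙′v) (from (absorbs⇔ x≤v v≤n) x≤pv)) }
    where open IsThreshold T

module _ {n : ℕ} {_∙_ : ℕ → ℕ → ℕ} where

  IsThreshold-resp-fun : ∀ {p q} → (∀ {w} → w ≤ n → p w ≡ q w) → IsThreshold n _∙_ p → IsThreshold n _∙_ q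
  IsThreshold-resp-fun p≡q T = record
    { deflationary = λ w≤n → subst (_≤ _) (p≡q w≤n) (deflationary w≤n)
    ; absorbs⇔     = λ x≤v v≤n → mk⇔
        (λ x∙v≡v → subst (_ ≤_) (p≡q v≤n) (to (absorbs⇔ x≤v v≤n) x∙v≡v))
        (λ x≤qv → from (absorbs⇔ x≤v v≤n) (subst (_ ≤_) (sym (p≡q v≤n)) x≤qv)) }
    where open IsThreshold T

  IsThreshold-unique : ∀ {p q} → IsThreshold n _∙_ p → IsThreshold n _∙_ q → ∀ {w} → w ≤ n → p w ≡ q w
  IsThreshold-unique {p} {q} Tp Tq w≤n = ≤-antisym (p≤q Tp Tq) (p≤q Tq Tp)
    where
    p≤q : ∀ {p q} → IsThreshold n _∙_ p → IsThreshold n _∙_ q → p _ ≤ q _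
    p≤q Tp Tq = to (absorbs⇔ Tq (deflationary Tp w≤n) w≤n) (from (absorbs⇔ Tp (deflationary Tp w≤n) w≤n) ≤-refl)
      where open IsThreshold

module BoundedDistanceMonoid {n : ℕ} {_∙_ : ℕ → ℕ → ℕ} (M : IsBoundedDistanceMonoid n _∙_) where

  open IsBoundedDistanceMonoid M

  absorbed-downward : ∀ {x y v} → x ≤ y → y ≤ v → v ≤ n → y ∙ v ≡ v → x ∙ v ≡ v
  absorbed-downward {x} {y} {v} x≤y y≤v v≤n y∙v≡v = ≤-antisym
    (subst (x ∙ v ≤_) y∙v≡v (∙-mono x≤y ≤-refl y≤n v≤n))
    (subst (v ≤_) (∙-comm v≤n x≤n) (≤-∙ v≤n x≤n))
    where
    y≤n = ≤-trans y≤v v≤n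
    x≤n = ≤-trans x≤y y≤n

  threshold-isThreshold : IsThreshold n _∙_ (threshold _∙_)
  threshold-isThreshold = record
    { deflationary = λ {w} _ → maxUpTo-≤ (λ x → x ∙ w ≟ w) w
    ; absorbs⇔     = λ {x} {v} x≤v v≤n → mk⇔
        (maxUpTo-maximal (λ x → x ∙ v ≟ v) v x≤v)
        (λ x≤θv → absorbed-downward x≤θv (maxUpTo-≤ (λ x → x ∙ v ≟ v) v) v≤n
                    (maxUpTo-satisfies (λ x → x ∙ v ≟ v) (trans (∙-comm z≤n v≤n) (∙-identityʳ v≤n)) v)) }

  module _ {p : ℕ → ℕ} (T : IsThreshold n _∙_ p) where

    open IsThreshold T

    isDeflationaryRetraction : IsDeflationaryRetraction n p
    isDeflationaryRetraction = record
      { deflationary = deflationary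
      ; idempotent   = idempotent
      ; fixes-top    = ≤-antisym (deflationary ≤-refl) (to (absorbs⇔ ≤-refl ≤-refl)
                                   (≤-antisym (∙-closed ≤-refl ≤-refl) (≤-∙ ≤-refl ≤-refl)))
      }
      where
      idempotent : ∀ {w} → w ≤ n → p (p w) ≡ p w
      idempotent {w} w≤n = ≤-antisym (deflationary e≤n) (to (absorbs⇔ ≤-refl e≤n) e∙e≡e)
        where
        e   = p w
        e≤w = deflationary w≤n
        e≤n = ≤-trans e≤w w≤n
        e∙w≡w : e ∙ w ≡ w
        e∙w≡w = from (absorbs⇔ e≤w w≤n) ≤-refl
        e∙e≤w : e ∙ e ≤ w
        e∙e≤w = subst (e ∙ e ≤_) e∙w≡w (∙-mono ≤-refl e≤w e≤n w≤n)
        [e∙e]∙w≡w : (e ∙ e) ∙ w ≡ w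
        [e∙e]∙w≡w = trans (∙-assoc e≤n e≤n w≤n) (trans (cong (e ∙_) e∙w≡w) e∙w≡w)
        e∙e≡e : e ∙ e ≡ e
        e∙e≡e = ≤-antisym (to (absorbs⇔ e∙e≤w w≤n) [e∙e]∙w≡w) (≤-∙ e≤n e≤n)

    module _ (chain : AbsorbsChains n _∙_) where

      open RetractionMonoid isDeflationaryRetraction using (⊕-sorted; ⊕-comm; absorber-unique)

      ∙≡absorber : ∀ {x y} → x ≤ y → y ≤ n → x ∙ y ≡ absorber n p y x
      ∙≡absorber {x} {y} x≤y y≤n = sym (absorber-unique y≤n x≤n
        (subst (y ≤_) (∙-comm y≤n x≤n) (≤-∙ y≤n x≤n))
        (to (absorbs⇔ (≤-∙ x≤n y≤n) (∙-closed x≤n y≤n)) (chain ≤-refl x≤y y≤n))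
        (λ {w} y≤w w≤n x≤pw → subst (x ∙ y ≤_) (from (absorbs⇔ (≤-trans x≤y y≤w) w≤n) x≤pw)
                                    (∙-mono ≤-refl y≤w x≤n w≤n)))
        where x≤n = ≤-trans x≤y y≤n

      ∙≡retractionOp : ∀ {x y} → x ≤ n → y ≤ n → x ∙ y ≡ retractionOp n p x y
      ∙≡retractionOp {x} {y} x≤n y≤n with ≤-total x y
      ... | inj₁ x≤y = trans (∙≡absorber x≤y y≤n) (sym (⊕-sorted x≤y))
      ... | inj₂ y≤x = begin
        x ∙ y                ≡⟨ ∙-comm x≤n y≤n ⟩
        y ∙ x                ≡⟨ ∙≡absorber y≤x x≤n ⟩
        absorber n p x y     ≡⟨ ⊕-sorted y≤x ⟨
        retractionOp n p y x ≡⟨ ⊕-comm y x ⟩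
        retractionOp n p x y ∎

-- m as an element of Fin (suc n), cut off at n
clamp : (n : ℕ) → ℕ → Fin (suc n)
clamp n       zero    = Fin.zero
clamp zero    (suc m) = Fin.zero
clamp (suc n) (suc m) = Fin.suc (clamp n m)

toℕ-clamp : ∀ {n m} → m ≤ n → toℕ (clamp n m) ≡ m
toℕ-clamp {m = zero}  _         = refl
toℕ-clamp {suc n} {suc m} (s≤s m≤n) = cong suc (toℕ-clamp m≤n)

clamp-toℕ : ∀ {n} (i : Fin (suc n)) → clamp n (toℕ i) ≡ i
clamp-toℕ                Fin.zero    = refl
clamp-toℕ {suc n} (Fin.suc i) = cong Fin.suc (clamp-toℕ i)

opℕ : ∀ {n} → Table (suc n) → ℕ → ℕ → ℕ
opℕ {n} t a b = toℕ (op t (clamp n a) (clamp n b))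

tableOf : (n : ℕ) → (ℕ → ℕ → ℕ) → Table (suc n)
tableOf n _∙_ = Vec.tabulate (λ a → Vec.tabulate (λ b → clamp n (toℕ a ∙ toℕ b)))

module _ {n : ℕ} where

  op-tableOf : ∀ _∙_ (a b : Fin (suc n)) → op (tableOf n _∙_) a b ≡ clamp n (toℕ a ∙ toℕ b)
  op-tableOf _∙_ a b = trans (cong (λ row → lookup row b) (Vec.lookup∘tabulate (Vec.tabulate ∘ entry) a))
                             (Vec.lookup∘tabulate (entry a) b)
    where
    entry : Fin (suc n) → Fin (suc n) → Fin (suc n)
    entry a b = clamp n (toℕ a ∙ toℕ b)

  toℕ-op-tableOf : ∀ {_∙_} → (∀ {a b} → a ≤ n → b ≤ n → a ∙ b ≤ n) →
                   ∀ (a b : Fin (suc n)) → toℕ (op (tableOf n _∙_) a b) ≡ toℕ a ∙ toℕ b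
  toℕ-op-tableOf {_∙_} ∙-closed a b =
    trans (cong toℕ (op-tableOf _∙_ a b)) (toℕ-clamp (∙-closed (toℕ≤pred[n] a) (toℕ≤pred[n] b)))

  tableOf-opℕ : (t : Table (suc n)) → tableOf n (opℕ t) ≡ t
  tableOf-opℕ t = begin
    Vec.tabulate (λ a → Vec.tabulate (λ b → clamp n (toℕ (op t (clamp n (toℕ a)) (clamp n (toℕ b))))))
      ≡⟨ Vec.tabulate-cong (λ a → Vec.tabulate-cong (λ b →
           trans (clamp-toℕ _) (cong₂ (op t) (clamp-toℕ a) (clamp-toℕ b)))) ⟩
    Vec.tabulate (λ a → Vec.tabulate (lookup (lookup t a)))
      ≡⟨ Vec.tabulate-cong (λ a → Vec.tabulate∘lookup (lookup t a)) ⟩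
    Vec.tabulate (lookup t)
      ≡⟨ Vec.tabulate∘lookup t ⟩
    t ∎

  tableOf-cong : ∀ {_∙_ _∙′_} → (∀ {a b} → a ≤ n → b ≤ n → a ∙ b ≡ a ∙′ b) →
                 tableOf n _∙_ ≡ tableOf n _∙′_
  tableOf-cong ∙≡∙′ = Vec.tabulate-cong (λ a → Vec.tabulate-cong (λ b →
    cong (clamp n) (∙≡∙′ (toℕ≤pred[n] a) (toℕ≤pred[n] b))))

  opℕ-tableOf : ∀ {_∙_} → (∀ {a b} → a ≤ n → b ≤ n → a ∙ b ≤ n) →
                ∀ {a b} → a ≤ n → b ≤ n → opℕ (tableOf n _∙_) a b ≡ a ∙ b
  opℕ-tableOf {_∙_} ∙-closed {a} {b} a≤n b≤n = trans (toℕ-op-tableOf ∙-closed (clamp n a) (clamp n b))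
    (cong₂ _∙_ (toℕ-clamp a≤n) (toℕ-clamp b≤n))

module _ {N : ℕ} {P : Fin N → Set} where

  All-allFin⁻ : All P (allFin N) → ∀ i → P i
  All-allFin⁻ = All.tabulate⁻ {f = id}

  All-allFin⁺ : (∀ i → P i) → All P (allFin N)
  All-allFin⁺ = All.tabulate⁺ {f = id}

module _ {n : ℕ} {t : Table (suc n)} {z : Fin (suc n)} where

  private
    _⊕_ = op t

  archProp⇔ : ∀ {m} → ArchProp t z m ⇔
              (∀ (r : Vec (Fin (suc n)) (suc m)) → IsChain t z r → bigSum t z r ≡ bigSum t z (Vec.tail r))
  archProp⇔ = mk⇔ (λ A r → All.lookup A (∈-vecsOver _ ∈-allFin r)) (λ H → All.tabulate (λ {r} _ → H r))

  archProp0-fails : 1 ≤ n → (∀ r → r ⊕ z ≡ r) → ¬ ArchProp t z 0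
  archProp0-fails 1≤n ⊕-identityʳ A = <⇒≢ 1≤n (sym (trans (sym (toℕ-fromℕ n)) (cong toℕ top≡0)))
    where
    ≡z : ∀ r → r ≡ z
    ≡z r = trans (sym (⊕-identityʳ r)) (to archProp⇔ A (r ∷ []) [])
    top≡0 : fromℕ n ≡ Fin.zero
    top≡0 = trans (≡z (fromℕ n)) (sym (≡z Fin.zero))

  archProp1⇒idempotent : (∀ r → r ⊕ z ≡ r) → ArchProp t z 1 → ∀ r → r ⊕ r ≡ r
  archProp1⇒idempotent ⊕-identityʳ A r = begin
    r ⊕ r        ≡⟨ cong (r ⊕_) (⊕-identityʳ r) ⟨
    r ⊕ (r ⊕ z)  ≡⟨ to archProp⇔ A (r ∷ r ∷ []) (≤-refl ∷ []) ⟩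
    r ⊕ z        ≡⟨ ⊕-identityʳ r ⟩
    r            ∎

  module DistanceMonoidTable (dm : IsDistanceMonoid t z) where

    private
      ≤-⊕ : ∀ r s → r Fin.≤ r ⊕ s
      ≤-⊕ r s = All-allFin⁻ (All-allFin⁻ (proj₁ dm) r) s
      ⊕-mono : ∀ {r s u v} → r Fin.≤ u → s Fin.≤ v → r ⊕ s Fin.≤ u ⊕ v
      ⊕-mono {r} {s} {u} {v} r≤u s≤v =
        All-allFin⁻ (All-allFin⁻ (All-allFin⁻ (All-allFin⁻ (proj₁ (proj₂ dm)) r) s) u) v (r≤u , s≤v)
      ⊕-comm : ∀ r s → r ⊕ s ≡ s ⊕ r
      ⊕-comm r s = All-allFin⁻ (All-allFin⁻ (proj₁ (proj₂ (proj₂ dm))) r) s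
      ⊕-assoc : ∀ r s u → (r ⊕ s) ⊕ u ≡ r ⊕ (s ⊕ u)
      ⊕-assoc r s u = All-allFin⁻ (All-allFin⁻ (All-allFin⁻ (proj₁ (proj₂ (proj₂ (proj₂ dm)))) r) s) u
      clamp-mono : ∀ {a b} → a ≤ b → b ≤ n → clamp n a Fin.≤ clamp n b
      clamp-mono a≤b b≤n = subst₂ _≤_ (sym (toℕ-clamp (≤-trans a≤b b≤n))) (sym (toℕ-clamp b≤n)) a≤b
      clamp-opℕ : ∀ a b → clamp n (opℕ t a b) ≡ clamp n a ⊕ clamp n b
      clamp-opℕ a b = clamp-toℕ _

    ⊕-identityʳ : ∀ r → r ⊕ z ≡ r
    ⊕-identityʳ = All-allFin⁻ (proj₂ (proj₂ (proj₂ (proj₂ dm))))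

    z≡0 : z ≡ Fin.zero
    z≡0 = toℕ-injective (n≤0⇒n≡0 (subst (toℕ z ≤_)
      (cong toℕ (trans (⊕-comm z Fin.zero) (⊕-identityʳ Fin.zero))) (≤-⊕ z Fin.zero)))

    opℕ-isBoundedDistanceMonoid : IsBoundedDistanceMonoid n (opℕ t)
    opℕ-isBoundedDistanceMonoid = record
      { ∙-closed    = λ _ _ → toℕ≤pred[n] _
      ; ≤-∙         = λ {a} {b} a≤n _ → subst (_≤ opℕ t a b) (toℕ-clamp a≤n) (≤-⊕ (clamp n a) (clamp n b))
      ; ∙-mono      = λ a≤c b≤d c≤n d≤n → ⊕-mono (clamp-mono a≤c c≤n) (clamp-mono b≤d d≤n)
      ; ∙-comm      = λ {a} {b} _ _ → cong toℕ (⊕-comm (clamp n a) (clamp n b))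
      ; ∙-assoc     = λ {a} {b} {c} _ _ _ → cong toℕ (begin
          clamp n (opℕ t a b) ⊕ clamp n c            ≡⟨ cong (_⊕ clamp n c) (clamp-opℕ a b) ⟩
          (clamp n a ⊕ clamp n b) ⊕ clamp n c        ≡⟨ ⊕-assoc _ _ _ ⟩
          clamp n a ⊕ (clamp n b ⊕ clamp n c)        ≡⟨ cong (clamp n a ⊕_) (clamp-opℕ b c) ⟨
          clamp n a ⊕ clamp n (opℕ t b c)            ∎)
      ; ∙-identityʳ = λ {a} a≤n → trans
          (cong toℕ (trans (cong (clamp n a ⊕_) (sym z≡0)) (⊕-identityʳ (clamp n a)))) (toℕ-clamp a≤n)
      }

    opℕ-absorbsChains : ArchProp t z 2 → AbsorbsChains n (opℕ t)
    opℕ-absorbsChains A {a} {b} {c} a≤b b≤c c≤n = cong toℕ (begin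
      clamp n a ⊕ clamp n (opℕ t b c)            ≡⟨ cong (clamp n a ⊕_) (clamp-opℕ b c) ⟩
      clamp n a ⊕ (clamp n b ⊕ clamp n c)        ≡⟨ cong (λ w → clamp n a ⊕ (clamp n b ⊕ w))
                                                         (⊕-identityʳ (clamp n c)) ⟨
      clamp n a ⊕ (clamp n b ⊕ (clamp n c ⊕ z))  ≡⟨ to archProp⇔ A (clamp n a ∷ clamp n b ∷ clamp n c ∷ [])
                                                      (clamp-mono a≤b b≤n ∷ clamp-mono b≤c c≤n ∷ []) ⟩
      clamp n b ⊕ (clamp n c ⊕ z)                ≡⟨ cong (clamp n b ⊕_) (⊕-identityʳ (clamp n c)) ⟩
      clamp n b ⊕ clamp n c                      ∎)
      where b≤n = ≤-trans b≤c c≤n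

    idempotent⇒archProp1 : (∀ {v} → v ≤ n → opℕ t v v ≡ v) → ArchProp t z 1
    idempotent⇒archProp1 idem = from archProp⇔ sums
      where
      ⊕-idem : ∀ r → r ⊕ r ≡ r
      ⊕-idem r = toℕ-injective (begin
        toℕ (r ⊕ r)                           ≡⟨ cong₂ (λ u w → toℕ (u ⊕ w)) (clamp-toℕ r) (clamp-toℕ r) ⟨
        opℕ t (toℕ r) (toℕ r)                 ≡⟨ idem (toℕ≤pred[n] r) ⟩
        toℕ r                                 ∎)
      absorbed : ∀ {a b} → a Fin.≤ b → a ⊕ b ≡ b
      absorbed {a} {b} a≤b = toℕ-injective (≤-antisym
        (subst (a ⊕ b Fin.≤_) (⊕-idem b) (⊕-mono a≤b (≤-refl {toℕ b})))
        (subst (b Fin.≤_) (⊕-comm b a) (≤-⊕ b a)))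
      sums : ∀ r → IsChain t z r → bigSum t z r ≡ bigSum t z (Vec.tail r)
      sums (a ∷ b ∷ []) (a≤b ∷ []) =
        trans (cong (a ⊕_) (⊕-identityʳ b)) (trans (absorbed a≤b) (sym (⊕-identityʳ b)))

module TableOf {n : ℕ} {_∙_ : ℕ → ℕ → ℕ} (M : IsBoundedDistanceMonoid n _∙_) where

  open IsBoundedDistanceMonoid M

  private
    t = tableOf n _∙_
    _⊕_ = op t
    toℕ-⊕ : ∀ r s → toℕ (r ⊕ s) ≡ toℕ r ∙ toℕ s
    toℕ-⊕ = toℕ-op-tableOf ∙-closed
    bound : ∀ (r : Fin (suc n)) → toℕ r ≤ n
    bound = toℕ≤pred[n]

  ⊕-identityʳ : ∀ r → r ⊕ Fin.zero ≡ r
  ⊕-identityʳ r = toℕ-injective (trans (toℕ-⊕ r Fin.zero) (∙-identityʳ (bound r)))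

  isDistanceMonoid : IsDistanceMonoid t Fin.zero
  isDistanceMonoid =
      All-allFin⁺ (λ r → All-allFin⁺ λ s → subst (toℕ r ≤_) (sym (toℕ-⊕ r s)) (≤-∙ (bound r) (bound s)))
    , All-allFin⁺ (λ r → All-allFin⁺ λ s → All-allFin⁺ λ u → All-allFin⁺ λ v → λ (r≤u , s≤v) →
        subst₂ _≤_ (sym (toℕ-⊕ r s)) (sym (toℕ-⊕ u v)) (∙-mono r≤u s≤v (bound u) (bound v)))
    , All-allFin⁺ (λ r → All-allFin⁺ λ s → toℕ-injective (begin
        toℕ (r ⊕ s)      ≡⟨ toℕ-⊕ r s ⟩
        toℕ r ∙ toℕ s    ≡⟨ ∙-comm (bound r) (bound s) ⟩
        toℕ s ∙ toℕ r    ≡⟨ toℕ-⊕ s r ⟨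
        toℕ (s ⊕ r)      ∎))
    , All-allFin⁺ (λ r → All-allFin⁺ λ s → All-allFin⁺ λ u → toℕ-injective (begin
        toℕ ((r ⊕ s) ⊕ u)          ≡⟨ toℕ-⊕ (r ⊕ s) u ⟩
        toℕ (r ⊕ s) ∙ toℕ u        ≡⟨ cong (_∙ toℕ u) (toℕ-⊕ r s) ⟩
        (toℕ r ∙ toℕ s) ∙ toℕ u    ≡⟨ ∙-assoc (bound r) (bound s) (bound u) ⟩
        toℕ r ∙ (toℕ s ∙ toℕ u)    ≡⟨ cong (toℕ r ∙_) (toℕ-⊕ s u) ⟨
        toℕ r ∙ toℕ (s ⊕ u)        ≡⟨ toℕ-⊕ r (s ⊕ u) ⟨
        toℕ (r ⊕ (s ⊕ u))          ∎))
    , All-allFin⁺ ⊕-identityʳ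

  archProp2 : AbsorbsChains n _∙_ → ArchProp t Fin.zero 2
  archProp2 chain = from (archProp⇔ {t = t}) sums
    where
    sums : ∀ r → IsChain t Fin.zero r → bigSum t Fin.zero r ≡ bigSum t Fin.zero (Vec.tail r)
    sums (a ∷ b ∷ c ∷ []) (a≤b ∷ b≤c ∷ []) = begin
      a ⊕ (b ⊕ (c ⊕ Fin.zero))  ≡⟨ cong (λ w → a ⊕ (b ⊕ w)) (⊕-identityʳ c) ⟩
      a ⊕ (b ⊕ c)               ≡⟨ toℕ-injective (begin
          toℕ (a ⊕ (b ⊕ c))           ≡⟨ toℕ-⊕ a (b ⊕ c) ⟩
          toℕ a ∙ toℕ (b ⊕ c)         ≡⟨ cong (toℕ a ∙_) (toℕ-⊕ b c) ⟩
          toℕ a ∙ (toℕ b ∙ toℕ c)     ≡⟨ chain a≤b b≤c (bound c) ⟩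
          toℕ b ∙ toℕ c               ≡⟨ toℕ-⊕ b c ⟨
          toℕ (b ⊕ c)                 ∎) ⟩
      b ⊕ c                     ≡⟨ cong (b ⊕_) (⊕-identityʳ c) ⟨
      b ⊕ (c ⊕ Fin.zero)        ∎

  archProp1⇒∙-idempotent : ArchProp t Fin.zero 1 → ∀ {v} → v ≤ n → v ∙ v ≡ v
  archProp1⇒∙-idempotent A {v} v≤n = begin
    v ∙ v                              ≡⟨ cong₂ _∙_ (toℕ-clamp v≤n) (toℕ-clamp v≤n) ⟨
    toℕ (clamp n v) ∙ toℕ (clamp n v)  ≡⟨ toℕ-⊕ (clamp n v) (clamp n v) ⟨
    toℕ (clamp n v ⊕ clamp n v)        ≡⟨ cong toℕ (archProp1⇒idempotent {t = t} ⊕-identityʳ A (clamp n v)) ⟩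
    toℕ (clamp n v)                    ≡⟨ toℕ-clamp v≤n ⟩
    v                                  ∎

module Correspondence (n : ℕ) (1≤n : 1 ≤ n) where

  candidates : List (Table (suc n) × Fin (suc n))
  candidates = cartesianProduct (vecsOver (vecsOver (allFin (suc n)) (suc n)) (suc n)) (allFin (suc n))

  isArch2DM? : (x : Table (suc n) × Fin (suc n)) →
               Dec (IsDistanceMonoid (proj₁ x) (proj₂ x) × HasArch (proj₁ x) (proj₂ x) 2)
  isArch2DM? x = isDistanceMonoid? (proj₁ x) (proj₂ x) ×-dec hasArch? (proj₁ x) (proj₂ x) 2

  arch2DMs : List (Table (suc n) × Fin (suc n))
  arch2DMs = filter isArch2DM? candidates

  arch2DMs-unique : Unique arch2DMs
  arch2DMs-unique = Unique.filter⁺ isArch2DM? (Unique.cartesianProduct⁺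
    (vecsOver-unique _ (vecsOver-unique _ (Unique.allFin⁺ (suc n)) (suc n)) (suc n)) (Unique.allFin⁺ (suc n)))

  ∈-arch2DMs : ∀ {t z} → IsDistanceMonoid t z → HasArch t z 2 → (t , z) ∈ arch2DMs
  ∈-arch2DMs {t} {z} dm arch = ∈-filter⁺ isArch2DM?
    (∈-cartesianProduct⁺ (∈-vecsOver _ (∈-vecsOver _ ∈-allFin) t) (∈-allFin z)) (dm , arch)

  encode : List ℕ → Table (suc n) × Fin (suc n)
  encode ps = tableOf n (retractionOp n (nth ps)) , Fin.zero

  decode : Table (suc n) × Fin (suc n) → List ℕ
  decode (t , _) = code n (threshold (opℕ t))

  module Encoding {ps : List ℕ} (ps∈ : ps ∈ nonIdentityCodes n) where

    private
      p = nth ps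
      table = tableOf n (retractionOp n p)
      ps∈codes×ps≢id : ps ∈ retractionCodes n × ps ≢ code n id
      ps∈codes×ps≢id = ∈-filter⁻ (isNonIdentity? n) {xs = retractionCodes n} ps∈
      ps≡code : ps ≡ code n p
      ps≡code = ∈-retractionCodes⇒≡code {n} (proj₁ ps∈codes×ps≢id)
      R : IsDeflationaryRetraction n p
      R = to code∈retractionCodes⇔ (subst (_∈ retractionCodes n) ps≡code (proj₁ ps∈codes×ps≢id))
      open IsDeflationaryRetraction R using (deflationary)
      open RetractionMonoid R using (isBoundedDistanceMonoid; absorbsChains; isThreshold)
      open IsBoundedDistanceMonoid isBoundedDistanceMonoid using (∙-closed)
      open IsThreshold isThreshold using (absorbs⇔)
      module T = TableOf isBoundedDistanceMonoid

    not-idempotent : ¬ (∀ {v} → v ≤ n → retractionOp n p v v ≡ v)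
    not-idempotent idem = proj₂ ps∈codes×ps≢id (trans ps≡code (code-cong n λ v≤n →
      ≤-antisym (deflationary v≤n) (to (absorbs⇔ ≤-refl v≤n) (idem v≤n))))

    encode-∈ : encode ps ∈ arch2DMs
    encode-∈ = ∈-arch2DMs {table} {Fin.zero} T.isDistanceMonoid
      ( T.archProp2 absorbsChains
      , archProp0-fails {t = table} 1≤n T.⊕-identityʳ ∷ not-idempotent ∘ T.archProp1⇒∙-idempotent ∷ [])

    decode-encode : decode (encode ps) ≡ ps
    decode-encode = begin
      code n (threshold (opℕ table)) ≡⟨ code-cong n (IsThreshold-unique θ-isThreshold p-isThreshold) ⟩
      code n p                       ≡⟨ ps≡code ⟨
      ps                             ∎
      where
      open DistanceMonoidTable {t = table} {z = Fin.zero} T.isDistanceMonoid using (opℕ-isBoundedDistanceMonoid)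
      θ-isThreshold = BoundedDistanceMonoid.threshold-isThreshold opℕ-isBoundedDistanceMonoid
      p-isThreshold = IsThreshold-resp-op (λ a≤n b≤n → sym (opℕ-tableOf ∙-closed a≤n b≤n)) isThreshold

  module Decoding {x : Table (suc n) × Fin (suc n)} (x∈ : x ∈ arch2DMs) where

    private
      t = proj₁ x
      z = proj₂ x
      dm×arch : IsDistanceMonoid t z × HasArch t z 2
      dm×arch = proj₂ (∈-filter⁻ isArch2DM? {xs = candidates} x∈)
      open DistanceMonoidTable {t = t} {z = z} (proj₁ dm×arch)
        using (z≡0; opℕ-isBoundedDistanceMonoid; opℕ-absorbsChains; idempotent⇒archProp1)
      open BoundedDistanceMonoid opℕ-isBoundedDistanceMonoid
      θ = threshold (opℕ t)
      p = nth (code n θ)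
      p-isThreshold = IsThreshold-resp-fun (λ w≤n → sym (nth-code n θ w≤n)) threshold-isThreshold

    not-archProp1 : ¬ ArchProp t z 1
    not-archProp1 with proj₂ (proj₂ dm×arch)
    ... | _ ∷ ¬archProp1 ∷ [] = ¬archProp1

    θ-not-id : code n θ ≢ code n id
    θ-not-id θ≡id = not-archProp1 (idempotent⇒archProp1 λ {v} v≤n →
      from (IsThreshold.absorbs⇔ threshold-isThreshold ≤-refl v≤n) (≤-reflexive (begin
        v                 ≡⟨ nth-code n id v≤n ⟨
        nth (code n id) v ≡⟨ cong (λ c → nth c v) θ≡id ⟨
        nth (code n θ) v  ≡⟨ nth-code n θ v≤n ⟩
        θ v               ∎)))

    decode-∈ : decode x ∈ nonIdentityCodes n
    decode-∈ = ∈-filter⁺ (isNonIdentity? n)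
      (from code∈retractionCodes⇔ (isDeflationaryRetraction threshold-isThreshold)) θ-not-id

    encode-decode : encode (decode x) ≡ x
    encode-decode = cong₂ _,_ (begin
      tableOf n (retractionOp n p) ≡⟨ tableOf-cong (∙≡retractionOp p-isThreshold chains) ⟨
      tableOf n (opℕ t)            ≡⟨ tableOf-opℕ t ⟩
      t                            ∎) (sym z≡0)
      where chains = opℕ-absorbsChains (proj₁ (proj₂ dm×arch))

theorem1p1 : (n : ℕ) → 2 ≤ n → DM n 2 ≡ rhs n
theorem1p1 n 2≤n = begin
  DM n 2                       ≡⟨ unique-inverses⇒length≡ decode encode arch2DMs-unique (nonIdentityCodes-unique n)
                                    (λ x∈ → Decoding.decode-∈ x∈ , Decoding.encode-decode x∈)
                                    (λ ps∈ → Encoding.encode-∈ ps∈ , Encoding.decode-encode ps∈) ⟩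
  length (nonIdentityCodes n)  ≡⟨ length-nonIdentityCodes n 1≤n ⟩
  rhs n                        ∎
  where
  1≤n = ≤-trans (s≤s z≤n) 2≤n
  open Correspondence n 1≤n
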